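{- Let $\mathcal{G}$ be a hereditary class of graphs, and let $c$ and $k$ denote, respectively, the maximum number of vertices and the maximum number of edges of a forbidden induced subgraph for $\mathcal{G}$. If $G$ is a forbidden induced subgraph for the edge-apex class $\mathcal{G}^{e}$, then $|V(G)|\le \max\{2c,\; c+k(c-2)\}$.
   Context: All graphs are finite, simple and undirected. A class of graphs is hereditary if it is closed under taking induced subgraphs. For a hereditary class $\mathcal{C}$, a forbidden induced subgraph for $\mathcal{C}$ is a graph $H$ not in $\mathcal{C}$ such that every proper induced subgraph of $H$ is in $\mathcal{C}$. The edge-apex class $\mathcal{G}^{e}$ of $\mathcal{G}$ is the class of graphs $G$ such that either $G\in\mathcal{G}$ or $G$ has an edge $e$ with $G-e\in\mathcal{G}$, where $G-e$ denotes deletion of the edge $e$ (keeping all vertices). -}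

module Defs where

open import Data.Nat using (ℕ; _<_; _≤_; _+_; _*_; _∸_; _⊔_; _<?_)
open import Data.Fin using (Fin; toℕ)
open import Data.Fin.Properties using (_≟_)
open import Data.Bool using (Bool; true; false; if_then_else_; _∧_; _∨_)
import Data.Bool as B
open import Data.List using (List; length; filter; allFin; concatMap; map)
open import Data.Product using (Σ; _×_; _,_; ∃; proj₁; proj₂)
open import Data.Sum using (_⊎_)
open import Relation.Binary.PropositionalEquality using (_≡_; refl)
open import Relation.Nullary using (¬_; Dec; does; yes; no; _×-dec_; _⊎-dec_)
open import Function.Definitions using (Injective)

record Graph : Set where
  field
    n      : ℕ
    adj    : Fin n → Fin n → Bool
    sym    : ∀ i j → adj i j ≡ adj j i
    irrefl : ∀ i → adj i i ≡ false
open Graph public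

record InducedSub (H G : Graph) : Set where
  field
    emb      : Fin (n H) → Fin (n G)
    emb-inj  : Injective _≡_ _≡_ emb
    emb-adj  : ∀ x y → adj H x y ≡ adj G (emb x) (emb y)

ProperInducedSub : Graph → Graph → Set
ProperInducedSub H G = InducedSub H G × (n H < n G)

GraphClass : Set₁
GraphClass = Graph → Set

Hereditary : GraphClass → Set
Hereditary 𝒢 = ∀ H G → InducedSub H G → 𝒢 G → 𝒢 H

Forbidden : GraphClass → Graph → Set
Forbidden 𝒢 H = ¬ 𝒢 H × (∀ H′ → ProperInducedSub H′ H → 𝒢 H′)

pairs : (m : ℕ) → List (Fin m × Fin m)
pairs m = concatMap (λ i → map (λ j → (i , j)) (allFin m)) (allFin m)

edgeCount : Graph → ℕ
edgeCount G = length (filter (λ p → (toℕ (proj₁ p) <? toℕ (proj₂ p)) ×-dec (adj G (proj₁ p) (proj₂ p) B.≟ true)) (pairs (n G)))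

_==_ : ∀ {m} → Fin m → Fin m → Bool
x == y = does (x ≟ y)

isUV : ∀ {m} → Fin m → Fin m → Fin m → Fin m → Bool
isUV u v x y = ((x == u) ∧ (y == v)) ∨ ((x == v) ∧ (y == u))

private
  swap4 : ∀ a b c d → ((a ∧ b) ∨ (c ∧ d)) ≡ ((d ∧ c) ∨ (b ∧ a))
  swap4 true true true true = refl
  swap4 true true true false = refl
  swap4 true true false true = refl
  swap4 true true false false = refl
  swap4 true false true true = refl
  swap4 true false true false = refl
  swap4 true false false true = refl
  swap4 true false false false = refl
  swap4 false true true true = refl
  swap4 false true true false = refl
  swap4 false true false true = refl
  swap4 false true false false = refl
  swap4 false false true true = refl
  swap4 false false true false = refl
  swap4 false false false true = refl
  swap4 false false false false = refl

deleteEdge : (G : Graph) → Fin (n G) → Fin (n G) → Graph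
deleteEdge G u v = record
  { n      = n G
  ; adj    = λ x y → if isUV u v x y then false else adj G x y
  ; sym    = symP
  ; irrefl = irrP
  }
  where
  symP : ∀ x y → (if isUV u v x y then false else adj G x y) ≡ (if isUV u v y x then false else adj G y x)
  symP x y rewrite swap4 (x == u) (y == v) (x == v) (y == u) | Graph.sym G x y = refl
  irrP : ∀ x → (if isUV u v x x then false else adj G x x) ≡ false
  irrP x with isUV u v x x
  ... | true = refl
  ... | false = irrefl G x

EdgeApex : GraphClass → GraphClass
EdgeApex 𝒢 G = 𝒢 G ⊎ Σ (Fin (n G)) (λ u → Σ (Fin (n G)) (λ v → (adj G u v ≡ true) × 𝒢 (deleteEdge G u v)))

IsMaxVertices : GraphClass → ℕ → Set
IsMaxVertices 𝒢 c = Σ Graph (λ H → Forbidden 𝒢 H × n H ≡ c) × (∀ H → Forbidden 𝒢 H → n H ≤ c)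

IsMaxEdges : GraphClass → ℕ → Set
IsMaxEdges 𝒢 k = Σ Graph (λ H → Forbidden 𝒢 H × edgeCount H ≡ k) × (∀ H → Forbidden 𝒢 H → edgeCount H ≤ k)

{-# OPTIONS --safe #-}
-- G ∉ 𝒢 contains a forbidden graph H of 𝒢, |H| ≤ c. Fix, for each edge ab of H, a forbidden
-- graph W_ab inside G − ab. No vertex v outside H can avoid all the W_ab: G − v lies in 𝒢ᵉ
-- by minimality of G, it is not in 𝒢 because it contains H, and (G − v) − e contains H
-- unless e is an edge ab of H, in which case it contains W_ab. So every vertex of G lies in
-- H or in some W_ab. If one W_xy meets H in at most one vertex, it contains no edge of H,
-- so it can serve as W_ab for every ab and |G| ≤ 2c. Otherwise every W_ab adds at most
-- c − 2 vertices to H, and there are at most k edges ab.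
-- Membership in 𝒢 is not decidable, so forbidden subgraphs are only obtained under a double
-- negation; it is discharged at the end because the inequality is decidable.
module Submission where

open import Defs hiding (sym)
open import Data.Bool using (true; false; if_then_else_; _∧_; _∨_)
import Data.Bool as B
open import Data.Bool.Properties using (∨-comm)
open import Data.Fin as Fin using (Fin; toℕ; punchIn; punchOut)
open import Data.Fin.Properties
  using ( _≟_; any?; ¬∀⟶∃¬; injective⇒≤; toℕ-injective
        ; punchIn-injective; punchIn-punchOut; punchOut-injective)
open import Data.List using (List; []; _∷_; _++_; length; concatMap; filter; tabulate; lookup)
open import Data.List.Properties using (length-++; length-tabulate)
open import Data.List.Membership.Propositional using (_∈_; _∉_; lose)
open import Data.List.Membership.Propositional.Properties
  using (∈-tabulate⁺; ∈-map⁺; ∈-concatMap⁺; ∈-filter⁺; ∈-++⁺ˡ; ∈-++⁺ʳ; ∈-allFin)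
import Data.List.Relation.Unary.Any as Any
open import Data.List.Relation.Unary.Any.Properties using (lookup-index)
open import Data.Nat using (ℕ; zero; suc; pred; _≤_; _<_; _+_; _*_; _∸_; _⊔_; _≤?_; _<?_; z≤n)
import Data.Nat.Properties as ℕ
open import Data.Nat.Induction using (<-wellFounded)
open import Data.Product using (Σ-syntax; ∃; ∃₂; _×_; _,_; proj₁; proj₂)
open import Data.Sum using (_⊎_; inj₁; inj₂)
import Data.Sum as Sum
open import Effect.Monad using (RawMonad)
open import Level using (0ℓ)
open import Function using (_∘_; _$_; id; case_of_)
open import Function.Bundles using (mk⇔)
open import Function.Definitions using (Injective)
open import Induction.WellFounded using (module All)
open import Relation.Binary.Construct.On using (wellFounded)
open import Relation.Binary.Definitions using (tri<; tri≈; tri>)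
open import Relation.Binary.PropositionalEquality
  using (_≡_; _≢_; refl; sym; trans; cong; cong₂; subst; subst₂)
open import Relation.Nullary using (¬_; Dec; yes; no; ¬?; _×-dec_; contradiction)
open import Relation.Nullary.Decidable using (decidable-stable; ¬¬-excluded-middle; does-⇔)
open import Relation.Nullary.Negation using (¬¬-Monad)

open RawMonad (¬¬-Monad {a = 0ℓ}) using (pure; _>>=_; _<$>_)
open InducedSub

¬¬-∀-Fin : ∀ {m} {P : Fin m → Set} → (∀ i → ¬ ¬ P i) → ¬ ¬ (∀ i → P i)
¬¬-∀-Fin {zero}  _   = pure λ ()
¬¬-∀-Fin {suc m} ¬¬P = do
  p₀ ← ¬¬P Fin.zero
  pₛ ← ¬¬-∀-Fin (¬¬P ∘ Fin.suc)
  pure λ { Fin.zero → p₀ ; (Fin.suc i) → pₛ i }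

_∈range_ : ∀ {A : Set} {m} → A → (Fin m → A) → Set
a ∈range f = ∃ λ i → f i ≡ a

_∈range?_ : ∀ {m N} (v : Fin N) (f : Fin m → Fin N) → Dec (v ∈range f)
v ∈range? f = any? λ i → f i ≟ v

surjective⇒≤ : ∀ {m N} (f : Fin m → Fin N) → (∀ v → v ∈range f) → N ≤ m
surjective⇒≤ f surj = injective⇒≤ section-injective
  where
  section-injective : Injective _≡_ _≡_ (proj₁ ∘ surj)
  section-injective {v} {w} eq = trans (sym (proj₂ (surj v))) (trans (cong f eq) (proj₂ (surj w)))

<⇒∃∉range : ∀ {m N} (f : Fin m → Fin N) → m < N → ∃ λ v → ¬ v ∈range f
<⇒∃∉range {N = N} f m<N = ¬∀⟶∃¬ N _ (_∈range? f) (ℕ.<⇒≱ m<N ∘ surjective⇒≤ f)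

all∈⇒≤length : ∀ {N} (L : List (Fin N)) → (∀ v → v ∈ L) → N ≤ length L
all∈⇒≤length L all∈ = surjective⇒≤ (lookup L) λ v → Any.index (all∈ v) , sym (lookup-index (all∈ v))

length-concatMap-≤ : ∀ {A B : Set} {b} (f : A → List B) → (∀ a → length (f a) ≤ b) →
                     ∀ xs → length (concatMap f xs) ≤ length xs * b
length-concatMap-≤ f f≤b []       = z≤n
length-concatMap-≤ f f≤b (x ∷ xs) = ℕ.≤-trans (ℕ.≤-reflexive (length-++ (f x)))
  (ℕ.+-mono-≤ (f≤b x) (length-concatMap-≤ f f≤b xs))

skip : ∀ {m} → Fin m → Fin (pred m) → Fin m
skip {suc m} v = punchIn v

skip-injective : ∀ {m} (v : Fin m) → Injective _≡_ _≡_ (skip v)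
skip-injective {suc m} v = punchIn-injective v _ _

skip-surjective : ∀ {m} {v w : Fin m} → w ≢ v → w ∈range skip v
skip-surjective {suc m} w≢v = punchOut (w≢v ∘ sym) , punchIn-punchOut (w≢v ∘ sym)

pred< : ∀ {m} → Fin m → pred m < m
pred< {suc m} _ = ℕ.n<1+n m

skip₂ : ∀ {m} {p q : Fin m} → p ≢ q → Fin (m ∸ 2) → Fin m
skip₂ {suc (suc m)} {p} p≢q = punchIn p ∘ punchIn (punchOut p≢q)

skip₂-surjective : ∀ {m} {p q r : Fin m} (p≢q : p ≢ q) → r ≢ p → r ≢ q → r ∈range skip₂ p≢q
skip₂-surjective {suc zero} {Fin.zero} {Fin.zero} p≢q = contradiction refl p≢q
skip₂-surjective {suc (suc m)} {p} {q} {r} p≢q r≢p r≢q =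
  punchOut q′≢r′ , trans (cong (punchIn p) (punchIn-punchOut q′≢r′)) (punchIn-punchOut p≢r)
  where
  p≢r : p ≢ r
  p≢r = r≢p ∘ sym
  q′≢r′ : punchOut p≢q ≢ punchOut p≢r
  q′≢r′ eq = r≢q (sym (punchOut-injective p≢q p≢r eq))

induced : (X : Graph) {m : ℕ} → (Fin m → Fin (n X)) → Graph
induced X {m} f = record
  { n      = m
  ; adj    = λ i j → adj X (f i) (f j)
  ; sym    = λ i j → Graph.sym X (f i) (f j)
  ; irrefl = irrefl X ∘ f
  }

induced-⊆ : (X : Graph) {m : ℕ} {f : Fin m → Fin (n X)} → Injective _≡_ _≡_ f → InducedSub (induced X f) X
induced-⊆ X {f = f} f-inj = record { emb = f ; emb-inj = f-inj ; emb-adj = λ _ _ → refl }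

_∖_ : (X : Graph) → Fin (n X) → Graph
X ∖ v = induced X (skip v)

∖-proper : (X : Graph) (v : Fin (n X)) → ProperInducedSub (X ∖ v) X
∖-proper X v = induced-⊆ X (skip-injective v) , pred< v

⊆-refl : ∀ {X} → InducedSub X X
⊆-refl = record { emb = id ; emb-inj = id ; emb-adj = λ _ _ → refl }

⊆-trans : ∀ {X Y Z} → InducedSub X Y → InducedSub Y Z → InducedSub X Z
⊆-trans g h = record
  { emb     = emb h ∘ emb g
  ; emb-inj = emb-inj g ∘ emb-inj h
  ; emb-adj = λ x y → trans (emb-adj g x y) (emb-adj h _ _)
  }

⊆-induced : ∀ {H X m} {f : Fin m → Fin (n X)} (g : InducedSub H X) →
            (∀ x → emb g x ∈range f) → InducedSub H (induced X f)
⊆-induced {X = X} {f = f} g covered = record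
  { emb     = proj₁ ∘ covered
  ; emb-inj = λ {x} {y} eq → emb-inj g (trans (sym (proj₂ (covered x))) (trans (cong f eq) (proj₂ (covered y))))
  ; emb-adj = λ x y → trans (emb-adj g x y) (sym (cong₂ (adj X) (proj₂ (covered x)) (proj₂ (covered y))))
  }

⊆-∖ : ∀ {H X} (g : InducedSub H X) {v} → ¬ v ∈range emb g → InducedSub H (X ∖ v)
⊆-∖ g v∉g = ⊆-induced g λ x → skip-surjective λ eq → v∉g (x , eq)

adj⇒≢ : (X : Graph) {x y : Fin (n X)} → adj X x y ≡ true → x ≢ y
adj⇒≢ X x~y refl = contradiction (trans (sym x~y) (irrefl X _)) λ ()

isUV⇒ends : ∀ {m} {s t x y : Fin m} → isUV s t x y ≡ true → (x ≡ s × y ≡ t) ⊎ (x ≡ t × y ≡ s)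
isUV⇒ends {s = s} {t} {x} {y} h with x ≟ s | y ≟ t | x ≟ t | y ≟ s
... | yes x≡s | yes y≡t | _       | _       = inj₁ (x≡s , y≡t)
... | _       | _       | yes x≡t | yes y≡s = inj₂ (x≡t , y≡s)
... | no _    | _       | no _    | _       = contradiction h λ ()
... | no _    | _       | yes _   | no _    = contradiction h λ ()
... | yes _   | no _    | no _    | _       = contradiction h λ ()
... | yes _   | no _    | yes _   | no _    = contradiction h λ ()

isUV⇒∈range : ∀ {m N} {s t : Fin N} (f : Fin m → Fin N) p q →
              isUV s t (f p) (f q) ≡ true → s ∈range f × t ∈range f
isUV⇒∈range f p q h with isUV⇒ends h
... | inj₁ (fp≡s , fq≡t) = (p , fp≡s) , (q , fq≡t)
... | inj₂ (fp≡t , fq≡s) = (q , fq≡s) , (p , fp≡t)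

isUV-injective : ∀ {m N} {f : Fin m → Fin N} → Injective _≡_ _≡_ f →
                 ∀ a b i j → isUV (f a) (f b) (f i) (f j) ≡ isUV a b i j
isUV-injective {f = f} f-inj a b i j =
  cong₂ _∨_ (cong₂ _∧_ (==-injective i a) (==-injective j b))
            (cong₂ _∧_ (==-injective i b) (==-injective j a))
  where
  ==-injective : ∀ x y → (f x == f y) ≡ (x == y)
  ==-injective x y = does-⇔ (mk⇔ f-inj (cong f)) (f x ≟ f y) (x ≟ y)

deleteEdge-adj : (X : Graph) {s t : Fin (n X)} (x y : Fin (n X)) →
                 (isUV s t x y ≡ true → adj X x y ≡ false) → adj (deleteEdge X s t) x y ≡ adj X x y
deleteEdge-adj X {s} {t} x y = if-false (isUV s t x y)
  where
  if-false : ∀ b {a} → (b ≡ true → a ≡ false) → (if b then false else a) ≡ a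
  if-false true  b⇒¬a = sym (b⇒¬a refl)
  if-false false _    = refl

⊆-deleteEdge : ∀ {H X s t} (g : InducedSub H X) → ¬ (s ∈range emb g × t ∈range emb g) →
               InducedSub H (deleteEdge X s t)
⊆-deleteEdge {X = X} g ¬both = record
  { emb     = emb g
  ; emb-inj = emb-inj g
  ; emb-adj = λ p q → trans (emb-adj g p q)
      (sym (deleteEdge-adj X _ _ λ h → contradiction (isUV⇒∈range (emb g) p q h) ¬both))
  }

deleteEdge-⊆ : ∀ {H X s t} (g : InducedSub H (deleteEdge X s t)) → ¬ (s ∈range emb g × t ∈range emb g) →
               InducedSub H X
deleteEdge-⊆ {X = X} g ¬both = record
  { emb     = emb g
  ; emb-inj = emb-inj g
  ; emb-adj = λ p q → trans (emb-adj g p q)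
      (deleteEdge-adj X _ _ λ h → contradiction (isUV⇒∈range (emb g) p q h) ¬both)
  }

deleteNonEdge-⊇ : (X : Graph) {s t : Fin (n X)} → adj X s t ≡ false → InducedSub X (deleteEdge X s t)
deleteNonEdge-⊇ X {s} {t} s≁t = record
  { emb = id ; emb-inj = id ; emb-adj = λ x y → sym (deleteEdge-adj X x y ends-nonadjacent) }
  where
  ends-nonadjacent : ∀ {x y} → isUV s t x y ≡ true → adj X x y ≡ false
  ends-nonadjacent {x} {y} h with isUV⇒ends {s = s} {t} {x} {y} h
  ... | inj₁ (refl , refl) = s≁t
  ... | inj₂ (refl , refl) = trans (Graph.sym X t s) s≁t

deleteEdge-comm : (X : Graph) {s t : Fin (n X)} → InducedSub (deleteEdge X t s) (deleteEdge X s t)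
deleteEdge-comm X {s} {t} = record
  { emb = id ; emb-inj = id
  ; emb-adj = λ x y → cong (λ b → if b then false else adj X x y) (∨-comm ((x == t) ∧ (y == s)) _)
  }

deleteEdge-induced : (X : Graph) {m : ℕ} {f : Fin m → Fin (n X)} → Injective _≡_ _≡_ f → ∀ {a b} →
                     InducedSub (induced (deleteEdge X (f a) (f b)) f) (deleteEdge (induced X f) a b)
deleteEdge-induced X {f = f} f-inj {a} {b} = record
  { emb = id ; emb-inj = id
  ; emb-adj = λ i j → cong (λ u → if u then false else adj X (f i) (f j)) (isUV-injective f-inj a b i j)
  }

record ForbiddenIn (𝒢 : GraphClass) (X : Graph) : Set where
  field
    graph     : Graph
    forbidden : Forbidden 𝒢 graph
    embedding : InducedSub graph X

  vertex : Fin (n graph) → Fin (n X)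
  vertex = emb embedding

open ForbiddenIn

forbiddenIn-mono : ∀ {𝒢 X Y} → InducedSub X Y → ForbiddenIn 𝒢 X → ForbiddenIn 𝒢 Y
forbiddenIn-mono X⊆Y F = record
  { graph = graph F ; forbidden = forbidden F ; embedding = ⊆-trans (embedding F) X⊆Y }

module _ {𝒢 : GraphClass} (her : Hereditary 𝒢) where

  ∉𝒢 : ∀ {F X} → Forbidden 𝒢 F → InducedSub F X → ¬ 𝒢 X
  ∉𝒢 F-forbidden F⊆X X∈𝒢 = proj₁ F-forbidden (her _ _ F⊆X X∈𝒢)

  deletions∈𝒢⇒forbidden : ∀ {X} → ¬ 𝒢 X → (∀ v → 𝒢 (X ∖ v)) → Forbidden 𝒢 X
  deletions∈𝒢⇒forbidden X∉𝒢 X∖v∈𝒢 = X∉𝒢 , λ where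
    F (F⊆X , F<X) → let v , v∉F = <⇒∃∉range (emb F⊆X) F<X
                    in her _ _ (⊆-∖ F⊆X v∉F) (X∖v∈𝒢 v)

  ¬¬forbiddenIn : ∀ X → ¬ 𝒢 X → ¬ ¬ ForbiddenIn 𝒢 X
  ¬¬forbiddenIn = All.wfRec (wellFounded n <-wellFounded) 0ℓ (λ X → ¬ 𝒢 X → ¬ ¬ ForbiddenIn 𝒢 X) step
    where
    step : ∀ X → (∀ {Y} → n Y < n X → ¬ 𝒢 Y → ¬ ¬ ForbiddenIn 𝒢 Y) →
           ¬ 𝒢 X → ¬ ¬ ForbiddenIn 𝒢 X
    step X smaller X∉𝒢 = do
      deletion? ← ¬¬-∀-Fin λ v → ¬¬-excluded-middle {A = 𝒢 (X ∖ v)}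
      case any? (λ v → ¬? (deletion? v)) of λ where
        (yes (v , X∖v∉𝒢)) → forbiddenIn-mono (proj₁ (∖-proper X v)) <$> smaller (pred< v) X∖v∉𝒢
        (no none) → pure record
          { graph     = X
          ; forbidden = deletions∈𝒢⇒forbidden X∉𝒢 λ v → decidable-stable (deletion? v) (none ∘ (v ,_))
          ; embedding = ⊆-refl
          }

edges : (X : Graph) → List (Fin (n X) × Fin (n X))
edges X = filter (λ p → (toℕ (proj₁ p) <? toℕ (proj₂ p)) ×-dec (adj X (proj₁ p) (proj₂ p) B.≟ true))
                 (pairs (n X))

∈-edges : (X : Graph) {x y : Fin (n X)} → toℕ x < toℕ y → adj X x y ≡ true → (x , y) ∈ edges X
∈-edges X {x} {y} x<y x~y = ∈-filter⁺ _ ∈-pairs (x<y , x~y)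
  where
  ∈-pairs : (x , y) ∈ pairs (n X)
  ∈-pairs = ∈-concatMap⁺ _ (lose (∈-allFin x) (∈-map⁺ (x ,_) (∈-allFin y)))

module ForbiddenForEdgeApex {𝒢 : GraphClass} (her : Hereditary 𝒢)
                            {G : Graph} (G-forbidden : Forbidden (EdgeApex 𝒢) G) where

  -- Also for non-edges st, so that witnesses can be chosen for all pairs of vertices.
  deleteEdge-∉𝒢 : ∀ s t → ¬ 𝒢 (deleteEdge G s t)
  deleteEdge-∉𝒢 s t G-st∈𝒢 with adj G s t in s~t
  ... | true  = proj₁ G-forbidden (inj₂ (s , t , s~t , G-st∈𝒢))
  ... | false = proj₁ G-forbidden (inj₁ (her _ _ (deleteNonEdge-⊇ G s~t) G-st∈𝒢))

  AvoidingWitness : Fin (n G) → Fin (n G) → Fin (n G) → Set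
  AvoidingWitness s t v = Σ[ W ∈ ForbiddenIn 𝒢 (deleteEdge G s t) ] ¬ v ∈range vertex W

  ¬avoidingWitness : ∀ {v a b} → 𝒢 (deleteEdge (G ∖ v) a b) → ¬ AvoidingWitness (skip v a) (skip v b) v
  ¬avoidingWitness {v} G∖v-ab∈𝒢 (W , v∉W) =
    ∉𝒢 her (forbidden W)
       (⊆-trans (⊆-∖ (embedding W) v∉W) (deleteEdge-induced G (skip-injective v))) G∖v-ab∈𝒢

  module WithForbiddenSubgraph (H : ForbiddenIn 𝒢 G) where

    Witness : Fin (n (graph H)) → Fin (n (graph H)) → Set
    Witness x y = ForbiddenIn 𝒢 (deleteEdge G (vertex H x) (vertex H y))

    Avoidable : Fin (n G) → Set
    Avoidable v = ∀ x y → adj (graph H) x y ≡ true → AvoidingWitness (vertex H x) (vertex H y) v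

    ∉H⇒¬avoidable : ∀ {v} → ¬ v ∈range vertex H → ¬ Avoidable v
    ∉H⇒¬avoidable {v} v∉H avoidable with proj₂ G-forbidden (G ∖ v) (∖-proper G v)
    ... | inj₁ G∖v∈𝒢 = ∉𝒢 her (forbidden H) (⊆-∖ (embedding H) v∉H) G∖v∈𝒢
    ... | inj₂ (a , b , a~b , G∖v-ab∈𝒢) with (skip v a ∈range? vertex H) ×-dec (skip v b ∈range? vertex H)
    ...   | yes ((x , x↦a) , (y , y↦b)) = ¬avoidingWitness G∖v-ab∈𝒢
      (subst₂ (λ s t → AvoidingWitness s t v) x↦a y↦b (avoidable x y x~y))
      where
      x~y : adj (graph H) x y ≡ true
      x~y = trans (emb-adj (embedding H) x y) (trans (cong₂ (adj G) x↦a y↦b) a~b)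
    ...   | no ¬both = ¬avoidingWitness G∖v-ab∈𝒢 (H-in-G-ab , v∉H)
      where
      H-in-G-ab : ForbiddenIn 𝒢 (deleteEdge G (skip v a) (skip v b))
      H-in-G-ab = record
        { graph = graph H ; forbidden = forbidden H ; embedding = ⊆-deleteEdge (embedding H) ¬both }

    _∈H∪_ : Fin (n G) → List (Fin (n G)) → Set
    v ∈H∪ R = v ∈range vertex H ⊎ v ∈ R

    witnesses⊆H∪R⇒bound : (R : List (Fin (n G))) →
      (∀ x y → adj (graph H) x y ≡ true →
         Σ[ W ∈ Witness x y ] ∀ p → vertex W p ∈H∪ R) →
      n G ≤ n (graph H) + length R
    witnesses⊆H∪R⇒bound R witness = begin
      n G                                      ≤⟨ all∈⇒≤length L all∈L ⟩
      length L                                 ≡⟨ length-++ (tabulate (vertex H)) ⟩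
      length (tabulate (vertex H)) + length R  ≡⟨ cong (_+ length R) (length-tabulate (vertex H)) ⟩
      n (graph H) + length R                   ∎
      where
      open ℕ.≤-Reasoning
      L : List (Fin (n G))
      L = tabulate (vertex H) ++ R
      ∈H∪R⇒∈L : ∀ {v} → v ∈H∪ R → v ∈ L
      ∈H∪R⇒∈L (inj₁ (x , refl)) = ∈-++⁺ˡ (∈-tabulate⁺ x)
      ∈H∪R⇒∈L (inj₂ v∈R)       = ∈-++⁺ʳ _ v∈R
      ∉L⇒⊥ : ∀ v → ¬ v ∉ L
      ∉L⇒⊥ v v∉L = ∉H⇒¬avoidable (v∉L ∘ ∈H∪R⇒∈L ∘ inj₁) λ x y x~y →
        let W , W⊆H∪R = witness x y x~y in W , λ { (p , refl) → v∉L (∈H∪R⇒∈L (W⊆H∪R p)) }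
      all∈L : ∀ v → v ∈ L
      all∈L v = decidable-stable (Any.any? (v ≟_) L) (∉L⇒⊥ v)

    MeetsTwice : ∀ {m} → (Fin m → Fin (n G)) → Set
    MeetsTwice f = ∃₂ λ p q → p ≢ q × f p ∈range vertex H × f q ∈range vertex H

    meetsTwice? : ∀ {m} (f : Fin m → Fin (n G)) → Dec (MeetsTwice f)
    meetsTwice? f = any? λ p → any? λ q →
      ¬? (p ≟ q) ×-dec (f p ∈range? vertex H) ×-dec (f q ∈range? vertex H)

    ¬meetsTwice⇒¬both : ∀ {m} {f : Fin m → Fin (n G)} {x y} → ¬ MeetsTwice f → x ≢ y →
                        ¬ (vertex H x ∈range f × vertex H y ∈range f)
    ¬meetsTwice⇒¬both {x = x} {y} ¬meets x≢y ((p , p↦x) , (q , q↦y)) =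
      ¬meets (p , q , p≢q , (x , sym p↦x) , (y , sym q↦y))
      where
      p≢q : _ ≢ _
      p≢q refl = x≢y (emb-inj (embedding H) (trans (sym p↦x) q↦y))

    outside : ∀ {m} → (Fin m → Fin (n G)) → List (Fin (n G))
    outside f with meetsTwice? f
    ... | yes (p , q , p≢q , _) = tabulate (f ∘ skip₂ p≢q)
    ... | no _                  = []

    length-outside : ∀ {m} (f : Fin m → Fin (n G)) → length (outside f) ≤ m ∸ 2
    length-outside f with meetsTwice? f
    ... | yes (p , q , p≢q , _) = ℕ.≤-reflexive (length-tabulate _)
    ... | no _                  = z≤n

    ∈H∪outside : ∀ {m} (f : Fin m → Fin (n G)) → MeetsTwice f → ∀ r → f r ∈H∪ outside f
    ∈H∪outside f meets r with meetsTwice? f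
    ... | no ¬meets = contradiction meets ¬meets
    ... | yes (p , q , p≢q , fp∈H , fq∈H) with r ≟ p | r ≟ q
    ...   | yes refl | _        = inj₁ fp∈H
    ...   | no _     | yes refl = inj₁ fq∈H
    ...   | no r≢p   | no r≢q   =
      let i , i↦r = skip₂-surjective p≢q r≢p r≢q
      in inj₂ (subst (λ j → f j ∈ _) i↦r (∈-tabulate⁺ i))

    thin-or-thick : (W : ∀ x y → Witness x y) →
      (∃₂ λ x y → adj (graph H) x y ≡ true × ¬ MeetsTwice (vertex (W x y))) ⊎
      (∀ x y → adj (graph H) x y ≡ true → MeetsTwice (vertex (W x y)))
    thin-or-thick W
      with any? (λ x → any? λ y → (adj (graph H) x y B.≟ true) ×-dec ¬? (meetsTwice? (vertex (W x y))))
    ... | yes thin = inj₁ thin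
    ... | no ¬thin = inj₂ λ x y x~y →
      decidable-stable (meetsTwice? _) λ ¬meets → ¬thin (x , y , x~y , ¬meets)

    module _ {c : ℕ} (maxV : ∀ F → Forbidden 𝒢 F → n F ≤ c) where

      thin⇒≤2c : ∀ {x₀ y₀} → x₀ ≢ y₀ → (W₀ : Witness x₀ y₀) →
                 ¬ MeetsTwice (vertex W₀) → n G ≤ 2 * c
      thin⇒≤2c x₀≢y₀ W₀ ¬meets = begin
        n G                                          ≤⟨ witnesses⊆H∪R⇒bound (tabulate (vertex W₀))
                                                          (λ x y x~y → W₀-in x y x~y , inj₂ ∘ ∈-tabulate⁺) ⟩
        n (graph H) + length (tabulate (vertex W₀))  ≡⟨ cong (n (graph H) +_) (length-tabulate _) ⟩
        n (graph H) + n (graph W₀)                   ≤⟨ ℕ.+-mono-≤ (maxV _ (forbidden H))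
                                                                     (maxV _ (forbidden W₀)) ⟩
        c + c                                        ≡⟨ cong (c +_) (sym (ℕ.+-identityʳ c)) ⟩
        2 * c                                        ∎
        where
        open ℕ.≤-Reasoning
        W₀⊆G : InducedSub (graph W₀) G
        W₀⊆G = deleteEdge-⊆ (embedding W₀) (¬meetsTwice⇒¬both ¬meets x₀≢y₀)
        W₀-in : ∀ x y → adj (graph H) x y ≡ true → Witness x y
        W₀-in x y x~y = record
          { graph     = graph W₀
          ; forbidden = forbidden W₀
          ; embedding = ⊆-deleteEdge W₀⊆G (¬meetsTwice⇒¬both ¬meets (adj⇒≢ (graph H) x~y))
          }

      thick⇒≤c+k[c∸2] : ∀ {k} → edgeCount (graph H) ≤ k →
                    (W : ∀ x y → Witness x y) →
                    (∀ x y → adj (graph H) x y ≡ true → MeetsTwice (vertex (W x y))) →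
                    n G ≤ c + k * (c ∸ 2)
      thick⇒≤c+k[c∸2] {k} |E|≤k W meets = begin
        n G                                     ≤⟨ witnesses⊆H∪R⇒bound R witness ⟩
        n (graph H) + length R                  ≤⟨ ℕ.+-mono-≤ (maxV _ (forbidden H))
                                                                (length-concatMap-≤ new new≤ E) ⟩
        c + length E * (c ∸ 2)                  ≤⟨ ℕ.+-monoʳ-≤ c (ℕ.*-monoˡ-≤ (c ∸ 2) |E|≤k) ⟩
        c + k * (c ∸ 2)                         ∎
        where
        open ℕ.≤-Reasoning
        E : List (Fin (n (graph H)) × Fin (n (graph H)))
        E = edges (graph H)
        new : Fin (n (graph H)) × Fin (n (graph H)) → List (Fin (n G))
        new (x , y) = outside (vertex (W x y))
        new≤ : ∀ e → length (new e) ≤ c ∸ 2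
        new≤ (x , y) = ℕ.≤-trans (length-outside (vertex (W x y)))
                                 (ℕ.∸-monoˡ-≤ 2 (maxV _ (forbidden (W x y))))
        R : List (Fin (n G))
        R = concatMap new E
        ordered-witness : ∀ x y → toℕ x < toℕ y → adj (graph H) x y ≡ true →
                          ∀ p → vertex (W x y) p ∈H∪ R
        ordered-witness x y x<y x~y p =
          Sum.map₂ (λ r∈new → ∈-concatMap⁺ new (lose (∈-edges (graph H) x<y x~y) r∈new))
                   (∈H∪outside _ (meets x y x~y) p)
        witness : ∀ x y → adj (graph H) x y ≡ true →
                  Σ[ W′ ∈ Witness x y ] ∀ p → vertex W′ p ∈H∪ R
        witness x y x~y with ℕ.<-cmp (toℕ x) (toℕ y)
        ... | tri< x<y _ _ = W x y , ordered-witness x y x<y x~y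
        ... | tri≈ _ x≡y _ = contradiction (toℕ-injective x≡y) (adj⇒≢ (graph H) x~y)
        ... | tri> _ _ y<x = forbiddenIn-mono (deleteEdge-comm G) (W y x) ,
                             ordered-witness y x y<x (trans (Graph.sym (graph H) y x) x~y)

proposition2p2 : (𝒢 : GraphClass) → Hereditary 𝒢 → (c k : ℕ)
    → IsMaxVertices 𝒢 c → IsMaxEdges 𝒢 k
    → (G : Graph) → Forbidden (EdgeApex 𝒢) G
    → n G ≤ (2 * c) ⊔ (c + k * (c ∸ 2))
proposition2p2 𝒢 her c k (_ , maxV) (_ , maxE) G G-forbidden =
  decidable-stable (n G ≤? (2 * c) ⊔ (c + k * (c ∸ 2))) do
    H ← ¬¬forbiddenIn her G (proj₁ G-forbidden ∘ inj₁)
    W ← ¬¬-∀-Fin λ x → ¬¬-∀-Fin λ y → ¬¬forbiddenIn her _ (deleteEdge-∉𝒢 (vertex H x) (vertex H y))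
    let open WithForbiddenSubgraph H
    pure $ case thin-or-thick W of λ where
      (inj₁ (x , y , x~y , thin)) → ℕ.m≤n⇒m≤n⊔o _ (thin⇒≤2c maxV (adj⇒≢ (graph H) x~y) (W x y) thin)
      (inj₂ thick)                → ℕ.m≤n⇒m≤o⊔n _ (thick⇒≤c+k[c∸2] maxV (maxE _ (forbidden H)) W thick)
  where open ForbiddenForEdgeApex her G-forbidden
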